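{- Let $(\mathbf{e}_i)_{i\in I}$ be an orthogonal family of transitive relations and let $\mathbf{e}=\bigcup_{i\in I}\mathbf{e}_i$ (which is transitive). Then: (i) a subset $\mathbf{x}\subseteq\mathbf{e}$ is closed (resp. open in $\mathbf{e}$) if and only if $\mathbf{x}\cap\mathbf{e}_i$ is closed (resp. open in $\mathbf{e}_i$) for each $i\in I$; (ii) $\mathrm{Reg}(\mathbf{e})\cong\prod_{i\in I}\mathrm{Reg}(\mathbf{e}_i)$, via an isomorphism that carries $\mathrm{Clop}(\mathbf{e})$ onto $\prod_{i\in I}\mathrm{Clop}(\mathbf{e}_i)$.
   Context: A family $(\mathbf{e}_i)_{i\in I}$ of pairwise disjoint transitive relations (sets of ordered pairs) is orthogonal if there are no distinct $i,j\in I$ and no $p,q,r$ with $p\neq q$, $q\neq r$, $(p,q)\in\mathbf{e}_i$ and $(q,r)\in\mathbf{e}_j$. For a transitive relation $\mathbf{f}$, a subset $\mathbf{a}\subseteq\mathbf{f}$ is closed if transitive, open in $\mathbf{f}$ if $\mathbf{f}\setminus\mathbf{a}$ is transitive, clopen if both; $\mathrm{cl}$ is transitive closure, $\mathrm{int}_{\mathbf{f}}(\mathbf{a})$ the largest subset of $\mathbf{a}$ open in $\mathbf{f}$; $\mathbf{a}$ is regular closed if $\mathbf{a}=\mathrm{cl}(\mathrm{int}_{\mathbf{f}}(\mathbf{a}))$. $\mathrm{Reg}(\mathbf{f})$ is the lattice of regular closed subsets of $\mathbf{f}$ under inclusion and $\mathrm{Clop}(\mathbf{f})$ the subposet of clopen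 subsets. -}

module Defs where

open import Level using (0ℓ)
open import Data.Product using (Σ; Σ-syntax; _×_; _,_; proj₁)
open import Relation.Nullary using (¬_)
open import Data.Empty using (⊥)
open import Relation.Binary.PropositionalEquality using (_≡_; _≢_)
open import Relation.Binary.Definitions using (Transitive)
open import Function.Bundles using (_⇔_)

Rel₀ : Set → Set₁
Rel₀ A = A → A → Set

module _ {A : Set} where

  _⊆_ : Rel₀ A → Rel₀ A → Set
  a ⊆ b = ∀ {p q} → a p q → b p q

  _≐_ : Rel₀ A → Rel₀ A → Set
  a ≐ b = (a ⊆ b) × (b ⊆ a)

  _∩_ : Rel₀ A → Rel₀ A → Rel₀ A
  (a ∩ b) p q = a p q × b p q

  _∖_ : Rel₀ A → Rel₀ A → Rel₀ A
  (f ∖ a) p q = f p q × ¬ a p q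

  ⋃ : {I : Set} → (I → Rel₀ A) → Rel₀ A
  ⋃ {I} e p q = Σ[ i ∈ I ] e i p q

  data cl (a : Rel₀ A) : Rel₀ A where
    [_]  : ∀ {p q} → a p q → cl a p q
    _∷_  : ∀ {p q r} → a p q → cl a q r → cl a p r

  Closed : Rel₀ A → Set
  Closed a = Transitive a

  OpenIn : Rel₀ A → Rel₀ A → Set
  OpenIn f a = (a ⊆ f) × Transitive (f ∖ a)

  Clopen : Rel₀ A → Rel₀ A → Set
  Clopen f a = (a ⊆ f) × Closed a × Transitive (f ∖ a)

  IsInterior : Rel₀ A → Rel₀ A → Rel₀ A → Set₁
  IsInterior f a b =
    (b ⊆ a) × OpenIn f b × (∀ (c : Rel₀ A) → c ⊆ a → OpenIn f c → c ⊆ b)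

  RegClosed : Rel₀ A → Rel₀ A → Set₁
  RegClosed f a = (a ⊆ f) × Σ[ b ∈ Rel₀ A ] (IsInterior f a b × (a ≐ cl b))

  -- carrier of the poset Reg(f) (ordered by ⊆ on first components)
  Reg : Rel₀ A → Set₁
  Reg f = Σ[ a ∈ Rel₀ A ] RegClosed f a

  PairwiseDisjoint : {I : Set} → (I → Rel₀ A) → Set
  PairwiseDisjoint {I} e = ∀ {i j : I} {p q : A} → i ≢ j → e i p q → e j p q → ⊥

  Orthogonal : {I : Set} → (I → Rel₀ A) → Set
  Orthogonal {I} e =
    ¬ (Σ[ i ∈ I ] Σ[ j ∈ I ] Σ[ p ∈ A ] Σ[ q ∈ A ] Σ[ r ∈ A ]
        (i ≢ j × p ≢ q × q ≢ r × e i p q × e j q r))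

  OrthogonalFamily : {I : Set} → (I → Rel₀ A) → Set
  OrthogonalFamily {I} e = (∀ i → Transitive (e i)) × PairwiseDisjoint e × Orthogonal e

module Submission where

-- Orthogonality says that a path p → q → r with p ≠ q ≠ r never
-- switches components; with excluded middle this becomes: two consecutive
-- pairs from different components have a trivial (reflexive) step.  Hence
-- (a) every pair of the union lies in exactly one component, and
-- (b) a transitive-closure chain in a subset of ⋃ e stays inside a single
--     component (`chain-in-component`).
-- From these, transitivity of x and of ⋃ e ∖ x can be checked componentwise,
-- which is part (i).  For part (ii) the maps are restriction a ↦ (a ∩ e i)ᵢ
-- and union (aᵢ)ᵢ ↦ ⋃ aᵢ.  Both preserve regular closedness because
-- interiors commute with restriction and union (`interior-restrict`,
-- `interior-union`) and so do closures (`restrict-regular`, `union-regular`);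
-- they are monotone, mutually inverse up to ≐, and preserve clopen sets by
-- part (i).

open import Defs
open import Level using (0ℓ)
open import Data.Product using (Σ-syntax; _×_; _,_; proj₁; proj₂)
open import Data.Sum using (_⊎_; inj₁; inj₂)
open import Data.Empty using (⊥; ⊥-elim)
open import Function.Bundles using (_⇔_; mk⇔; Equivalence)
open import Axiom.ExcludedMiddle using (ExcludedMiddle)
open import Relation.Nullary using (yes; no)
open import Relation.Binary.PropositionalEquality using (_≡_; _≢_; refl)
open import Relation.Binary.Definitions using (Transitive)

module _ {A : Set} where

  closed-resp-≐ : ∀ {a a' : Rel₀ A} → a ≐ a' → Closed a → Closed a'
  closed-resp-≐ (a⊆a' , a'⊆a) c x y = a⊆a' (c (a'⊆a x) (a'⊆a y))

  open-resp-≐ : ∀ {f a a' : Rel₀ A} → a ≐ a' → OpenIn f a → OpenIn f a'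
  open-resp-≐ {f} {a} {a'} (a⊆a' , a'⊆a) (a⊆f , t) = (λ z → a⊆f (a'⊆a z)) , t'
    where
    t' : Transitive (f ∖ a')
    t' (fx , ¬a'x) (fy , ¬a'y) with t (fx , λ z → ¬a'x (a⊆a' z)) (fy , λ z → ¬a'y (a⊆a' z))
    ... | fz , ¬az = fz , λ z → ¬az (a'⊆a z)

  clopen-resp-≐ : ∀ {f a a' : Rel₀ A} → a ≐ a' → Clopen f a → Clopen f a'
  clopen-resp-≐ eq (a⊆f , c , t) with open-resp-≐ eq (a⊆f , t)
  ... | a'⊆f , t' = a'⊆f , closed-resp-≐ eq c , t'

  empty-open : ∀ {f a : Rel₀ A} → Closed f → (∀ {p q} → a p q → ⊥) → OpenIn f a
  empty-open f-tr a-empty = (λ z → ⊥-elim (a-empty z)) , λ x y → f-tr (proj₁ x) (proj₁ y) , a-empty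

  cl-closed : ∀ {b : Rel₀ A} → Closed (cl b)
  cl-closed [ x ] r = x ∷ r
  cl-closed (x ∷ r) r' = x ∷ cl-closed r r'

  closure-closed : ∀ {a b : Rel₀ A} → a ≐ cl b → Closed a
  closure-closed (a⊆clb , clb⊆a) x y = clb⊆a (cl-closed (a⊆clb x) (a⊆clb y))

  cl-least : ∀ {b a : Rel₀ A} → b ⊆ a → Closed a → cl b ⊆ a
  cl-least b⊆a c [ x ] = b⊆a x
  cl-least b⊆a c (x ∷ r) = c (b⊆a x) (cl-least b⊆a c r)

  cl-mono : ∀ {b b' : Rel₀ A} → b ⊆ b' → cl b ⊆ cl b'
  cl-mono b⊆b' [ x ] = [ b⊆b' x ]
  cl-mono b⊆b' (x ∷ r) = b⊆b' x ∷ cl-mono b⊆b' r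

  module RegularParts {f a : Rel₀ A} (r : RegClosed f a) where
    interior : Rel₀ A
    interior = proj₁ (proj₂ r)

    interior-spec : IsInterior f a interior
    interior-spec = proj₁ (proj₂ (proj₂ r))

    regular : a ≐ cl interior
    regular = proj₂ (proj₂ (proj₂ r))

module Orthogonal (lem : ExcludedMiddle 0ℓ) {A I : Set} (e : I → Rel₀ A)
                  (family : OrthogonalFamily e) where

  E : Rel₀ A
  E = ⋃ e

  e-closed : ∀ i → Closed (e i)
  e-closed i x y = proj₁ family i x y

  orthogonal-step : ∀ {i j p q r} → i ≢ j → e i p q → e j q r → (p ≡ q) ⊎ (q ≡ r)
  orthogonal-step {i} {j} {p} {q} {r} i≢j pq qr with lem {p ≡ q} | lem {q ≡ r}
  ... | yes p≡q | _ = inj₁ p≡q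
  ... | no _    | yes q≡r = inj₂ q≡r
  ... | no p≢q  | no q≢r =
    ⊥-elim (proj₂ (proj₂ family) (i , j , p , q , r , i≢j , p≢q , q≢r , pq , qr))

  component-unique : ∀ {i j p q} → e i p q → e j p q → i ≡ j
  component-unique {i} {j} x y with lem {i ≡ j}
  ... | yes i≡j = i≡j
  ... | no i≢j = ⊥-elim (proj₁ (proj₂ family) i≢j x y)

  restrict-union : (g : I → Rel₀ A) → (∀ j → g j ⊆ e j) → ∀ i → g i ≐ (⋃ g ∩ e i)
  restrict-union g g⊆e i = (λ z → (i , z) , g⊆e i z) , back
    where
    back : (⋃ g ∩ e i) ⊆ g i
    back ((j , z) , x) with component-unique (g⊆e j z) x
    ... | refl = z

  union-restrict : ∀ {x : Rel₀ A} → x ⊆ E → ⋃ (λ i → x ∩ e i) ≐ x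
  union-restrict x⊆E = (λ z → proj₁ (proj₂ z)) , λ z → proj₁ (x⊆E z) , z , proj₂ (x⊆E z)

  union-⊆ : (g : I → Rel₀ A) → (∀ j → g j ⊆ e j) → ⋃ g ⊆ E
  union-⊆ g g⊆e (i , z) = i , g⊆e i z

  closed-restrict : ∀ {x : Rel₀ A} → Closed x → ∀ i → Closed (x ∩ e i)
  closed-restrict c i (x , a) (y , b) = c x y , e-closed i a b

  closed-glue : ∀ {x : Rel₀ A} → x ⊆ E → (∀ i → Closed (x ∩ e i)) → Closed x
  closed-glue x⊆E h {p} {q} {r} xpq xqr with x⊆E xpq | x⊆E xqr
  ... | i , a | j , b with lem {i ≡ j}
  ... | yes refl = proj₁ (h i (xpq , a) (xqr , b))
  ... | no i≢j with orthogonal-step i≢j a b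
  ... | inj₁ refl = xqr
  ... | inj₂ refl = xpq

  closed-iff : ∀ (x : Rel₀ A) → x ⊆ E → Closed x ⇔ (∀ i → Closed (x ∩ e i))
  closed-iff x x⊆E =
    mk⇔ (λ c → closed-restrict (λ {p} {q} {r} → c {p} {q} {r}))
        (λ h {p} {q} {r} → closed-glue x⊆E h {p} {q} {r})

  open-restrict : ∀ {x : Rel₀ A} → OpenIn E x → ∀ i → OpenIn (e i) (x ∩ e i)
  open-restrict {x} (_ , t) i = proj₂ , t'
    where
    t' : Transitive (e i ∖ (x ∩ e i))
    t' (a , ¬xa) (b , ¬xb) with t ((i , a) , λ z → ¬xa (z , a)) ((i , b) , λ z → ¬xb (z , b))
    ... | _ , ¬xc = e-closed i a b , λ z → ¬xc (proj₁ z)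

  open-glue : ∀ {x : Rel₀ A} → x ⊆ E → (∀ i → OpenIn (e i) (x ∩ e i)) → OpenIn E x
  open-glue {x} x⊆E h = x⊆E , t
    where
    t : Transitive (E ∖ x)
    t ((i , a) , ¬xa) ((j , b) , ¬xb) with lem {i ≡ j}
    ... | yes refl with proj₂ (h i) (a , λ z → ¬xa (proj₁ z)) (b , λ z → ¬xb (proj₁ z))
    ...   | c , ¬xc = (i , c) , λ z → ¬xc (z , c)
    t ((i , a) , ¬xa) ((j , b) , ¬xb) | no i≢j with orthogonal-step i≢j a b
    ... | inj₁ refl = (j , b) , ¬xb
    ... | inj₂ refl = (i , a) , ¬xa

  open-iff : ∀ (x : Rel₀ A) → x ⊆ E → OpenIn E x ⇔ (∀ i → OpenIn (e i) (x ∩ e i))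
  open-iff x x⊆E = mk⇔ open-restrict (open-glue x⊆E)

  clopen-iff : ∀ (x : Rel₀ A) → x ⊆ E → Clopen E x ⇔ (∀ i → Clopen (e i) (x ∩ e i))
  clopen-iff x x⊆E = mk⇔ forward backward
    where
    forward : Clopen E x → ∀ i → Clopen (e i) (x ∩ e i)
    forward (_ , c , t) i =
      proj₂ , closed-restrict (λ {p} {q} {r} → c {p} {q} {r}) i , proj₂ (open-restrict (x⊆E , t) i)
    backward : (∀ i → Clopen (e i) (x ∩ e i)) → Clopen E x
    backward h = x⊆E , closed-glue x⊆E (λ i → proj₁ (proj₂ (h i)))
                     , proj₂ (open-glue x⊆E (λ i → proj₁ (h i) , proj₂ (proj₂ (h i))))

  component-open : ∀ {i} {c : Rel₀ A} → c ⊆ e i → OpenIn (e i) c → OpenIn E c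
  component-open {i} {c} c⊆eᵢ c-open = open-glue (λ z → i , c⊆eᵢ z) restricted
    where
    restricted : ∀ j → OpenIn (e j) (c ∩ e j)
    restricted j with lem {i ≡ j}
    ... | yes refl = open-resp-≐ ((λ z → z , c⊆eᵢ z) , proj₁) c-open
    ... | no i≢j = empty-open (e-closed j) λ z → proj₁ (proj₂ family) i≢j (c⊆eᵢ (proj₁ z)) (proj₂ z)

  chain-in-component : ∀ {b : Rel₀ A} → b ⊆ E → ∀ {p q} → cl b p q → Σ[ k ∈ I ] cl (b ∩ e k) p q
  chain-in-component b⊆E [ x ] with b⊆E x
  ... | k , a = k , [ (x , a) ]
  chain-in-component b⊆E (x ∷ r) with b⊆E x | chain-in-component b⊆E r
  ... | j , a | k , r' with lem {j ≡ k}
  ... | yes refl = j , ((x , a) ∷ r')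
  ... | no j≢k with orthogonal-step j≢k a (cl-least proj₂ (e-closed k) r')
  ... | inj₁ refl = k , r'
  ... | inj₂ refl = j , [ (x , a) ]

  restrict-regular : ∀ {a b : Rel₀ A} → b ⊆ E → a ≐ cl b → ∀ i → (a ∩ e i) ≐ cl (b ∩ e i)
  restrict-regular {a} {b} b⊆E (a⊆clb , clb⊆a) i = into , outof
    where
    into : (a ∩ e i) ⊆ cl (b ∩ e i)
    into (z , x) with chain-in-component b⊆E (a⊆clb z)
    ... | k , chain with component-unique (cl-least proj₂ (e-closed k) chain) x
    ... | refl = chain
    outof : cl (b ∩ e i) ⊆ (a ∩ e i)
    outof = cl-least (λ z → clb⊆a [ proj₁ z ] , proj₂ z)
                     (closed-restrict (closure-closed (a⊆clb , clb⊆a)) i)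

  union-regular : (a b : I → Rel₀ A) → (∀ i → a i ⊆ e i) → (∀ i → a i ≐ cl (b i))
                → ⋃ a ≐ cl (⋃ b)
  union-regular a b a⊆e regular = into , cl-least b⊆⋃a ⋃a-closed
    where
    into : ⋃ a ⊆ cl (⋃ b)
    into (i , z) = cl-mono (i ,_) (proj₁ (regular i) z)
    b⊆⋃a : ⋃ b ⊆ ⋃ a
    b⊆⋃a (i , z) = i , proj₂ (regular i) [ z ]
    ⋃a-closed : Closed (⋃ a)
    ⋃a-closed = closed-glue (union-⊆ a a⊆e) λ i →
      closed-resp-≐ (restrict-union a a⊆e i) (closure-closed (regular i))

  interior-restrict : ∀ {a b : Rel₀ A} → IsInterior E a b → ∀ i → IsInterior (e i) (a ∩ e i) (b ∩ e i)
  interior-restrict {a} {b} (b⊆a , b-open , b-max) i =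
    (λ z → b⊆a (proj₁ z) , proj₂ z) , open-restrict b-open i , maximal
    where
    maximal : ∀ c → c ⊆ (a ∩ e i) → OpenIn (e i) c → c ⊆ (b ∩ e i)
    maximal c c⊆aeᵢ c-open z =
      b-max c (λ w → proj₁ (c⊆aeᵢ w)) (component-open (λ w → proj₂ (c⊆aeᵢ w)) c-open) z
      , proj₂ (c⊆aeᵢ z)

  interior-union : (a b : I → Rel₀ A) → (∀ i → a i ⊆ e i) → (∀ i → IsInterior (e i) (a i) (b i))
                 → IsInterior E (⋃ a) (⋃ b)
  interior-union a b a⊆e interiors = b⊆a , b-open , maximal
    where
    b⊆a : ⋃ b ⊆ ⋃ a
    b⊆a (i , z) = i , proj₁ (interiors i) z
    b-open : OpenIn E (⋃ b)
    b-open = open-glue (λ z → union-⊆ a a⊆e (b⊆a z)) λ i →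
      open-resp-≐ (restrict-union b (λ j z → a⊆e j (proj₁ (interiors j) z)) i)
                  (proj₁ (proj₂ (interiors i)))
    maximal : ∀ c → c ⊆ ⋃ a → OpenIn E c → c ⊆ ⋃ b
    maximal c c⊆a c-open z with c⊆a z
    ... | i , w = i , proj₂ (proj₂ (interiors i)) (c ∩ e i)
                        (λ v → proj₂ (restrict-union a a⊆e i) (c⊆a (proj₁ v) , proj₂ v))
                        (open-restrict c-open i) (z , a⊆e i w)

  restrictReg : Reg E → ∀ i → Reg (e i)
  restrictReg (a , a⊆E , b , b-interior , regular) i =
    (a ∩ e i) , proj₂ , (b ∩ e i) , interior-restrict b-interior i
    , restrict-regular (λ z → a⊆E (proj₁ b-interior z)) regular i

  unionReg : (∀ i → Reg (e i)) → Reg E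
  unionReg u =
    ⋃ a , union-⊆ a a⊆e , ⋃ b , interior-union a b a⊆e (λ i → interior-spec (reg i))
    , union-regular a b a⊆e (λ i → regular (reg i))
    where
    open RegularParts
    a : I → Rel₀ A
    a i = proj₁ (u i)
    reg : ∀ i → RegClosed (e i) (a i)
    reg i = proj₂ (u i)
    a⊆e : ∀ i → a i ⊆ e i
    a⊆e i = proj₁ (reg i)
    b : I → Rel₀ A
    b i = interior (reg i)

proposition7p6 : ExcludedMiddle 0ℓ → {A I : Set} → (e : I → Rel₀ A) → OrthogonalFamily e →
    ((x : Rel₀ A) → x ⊆ ⋃ e →
      (Closed x ⇔ (∀ i → Closed (x ∩ e i)))
      × (OpenIn (⋃ e) x ⇔ (∀ i → OpenIn (e i) (x ∩ e i))))
  × (Σ[ φ ∈ (Reg (⋃ e) → ((i : I) → Reg (e i))) ]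
     Σ[ ψ ∈ (((i : I) → Reg (e i)) → Reg (⋃ e)) ]
       ((∀ x y → proj₁ x ⊆ proj₁ y → ∀ i → proj₁ (φ x i) ⊆ proj₁ (φ y i))
      × (∀ u v → (∀ i → proj₁ (u i) ⊆ proj₁ (v i)) → proj₁ (ψ u) ⊆ proj₁ (ψ v))
      × (∀ x → proj₁ (ψ (φ x)) ≐ proj₁ x)
      × (∀ u i → proj₁ (φ (ψ u) i) ≐ proj₁ (u i))
      × (∀ x → Clopen (⋃ e) (proj₁ x) → ∀ i → Clopen (e i) (proj₁ (φ x i)))
      × (∀ u → (∀ i → Clopen (e i) (proj₁ (u i))) → Clopen (⋃ e) (proj₁ (ψ u)))))
proposition7p6 lem e family =
    (λ x x⊆E → closed-iff x x⊆E , open-iff x x⊆E)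
  , restrictReg , unionReg
  , (λ x y x⊆y i z → x⊆y (proj₁ z) , proj₂ z)
  , (λ u v u⊆v (i , z) → i , u⊆v i z)
  , (λ x → union-restrict (carrier⊆E x))
  , (λ u i → let (into , outof) = restrict-union (λ j → proj₁ (u j)) (componentwise⊆ u) i
             in outof , into)
  , (λ x → Equivalence.to (clopen-iff (proj₁ x) (carrier⊆E x)))
  , (λ u clopens → Equivalence.from (clopen-iff _ (union-⊆ _ (componentwise⊆ u)))
                     λ i → clopen-resp-≐ (restrict-union _ (componentwise⊆ u) i) (clopens i))
  where
  open Orthogonal lem e family
  carrier⊆E : (x : Reg E) → proj₁ x ⊆ E
  carrier⊆E x = proj₁ (proj₂ x)
  componentwise⊆ : (u : ∀ i → Reg (e i)) → ∀ i → proj₁ (u i) ⊆ e i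
  componentwise⊆ u i = proj₁ (proj₂ (u i))
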